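{- Let $T$ be a finite tree with at least $4$ vertices. Then the strong $3$-colour graph $S_3(T)$ is connected if and only if $T$ contains the path $P_5$ on $5$ vertices or the graph $I$ as a subgraph, where $I$ is the tree with vertex set $\{x_1,\dots,x_6\}$ and edge set $\{x_1x_2,\,x_2x_3,\,x_4x_5,\,x_5x_6,\,x_2x_5\}$.
   Context: A proper $k$-colouring of a graph $G$ is a map $V(G)\to\{1,\dots,k\}$ giving adjacent vertices different colours; it is strong if all $k$ colours appear. The strong $k$-colour graph $S_k(G)$ has the strong $k$-colourings of $G$ as vertices, two being adjacent iff they differ in colour on exactly one vertex of $G$. -}

module Defs where

open import Data.Nat using (ℕ; zero; suc; _≤_)
open import Data.Fin using (Fin; toℕ; zero; suc)
open import Data.Fin.Patterns
open import Data.List using (List; []; _∷_)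
open import Data.List.Relation.Unary.AllPairs using (AllPairs)
open import Data.List.Membership.Propositional using (_∈_)
open import Data.Product using (Σ; ∃; _×_; _,_)
open import Data.Sum using (_⊎_; inj₁; inj₂; [_,_]′; swap)
open import Data.Nat.Properties using (1+n≢n)
open import Relation.Binary.PropositionalEquality as Eq using ()
open import Data.List.Relation.Unary.Any using (here; there)
open import Relation.Binary.PropositionalEquality using (refl)
open import Data.Empty using (⊥)
open import Relation.Nullary using (¬_)
open import Relation.Binary.PropositionalEquality using (_≡_; _≢_)
open import Function.Definitions using (Injective)

record Graph (n : ℕ) : Set₁ where
  field
    Adj   : Fin n → Fin n → Set
    sym   : ∀ {u v} → Adj u v → Adj v u
    irrefl : ∀ {v} → ¬ Adj v v
open Graph public

data Walk {n : ℕ} (G : Graph n) : Fin n → Fin n → Set where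
  here : ∀ {v} → Walk G v v
  step : ∀ {u w v} → Adj G u w → Walk G w v → Walk G u v

Connected : ∀ {n} → Graph n → Set
Connected {n} G = ∀ (u v : Fin n) → Walk G u v

data IsPath {n : ℕ} (G : Graph n) : List (Fin n) → Set where
  single : ∀ v → IsPath G (v ∷ [])
  cons   : ∀ {u v vs} → Adj G u v → IsPath G (v ∷ vs) → IsPath G (u ∷ v ∷ vs)

last : ∀ {A : Set} → A → List A → A
last a []       = a
last a (b ∷ bs) = last b bs

HasCycle : ∀ {n} → Graph n → Set
HasCycle {n} G =
  Σ (Fin n) λ v₀ → Σ (Fin n) λ v₁ → Σ (Fin n) λ v₂ → Σ (List (Fin n)) λ vs →
    IsPath G (v₀ ∷ v₁ ∷ v₂ ∷ vs) ×
    AllPairs _≢_ (v₀ ∷ v₁ ∷ v₂ ∷ vs) ×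
    Adj G (last v₂ vs) v₀

IsTree : ∀ {n} → Graph n → Set
IsTree G = Connected G × ¬ HasCycle G

_⊆G_ : ∀ {k n} → Graph k → Graph n → Set
_⊆G_ {k} {n} H G =
  Σ (Fin k → Fin n) λ f → Injective _≡_ _≡_ f × (∀ i j → Adj H i j → Adj G (f i) (f j))

P5Adj : Fin 5 → Fin 5 → Set
P5Adj i j = (toℕ j ≡ suc (toℕ i)) ⊎ (toℕ i ≡ suc (toℕ j))

-- I on vertices x₁,…,x₆ encoded as 0,…,5:
-- edges x₁x₂, x₂x₃, x₄x₅, x₅x₆, x₂x₅
I-edges : List (Fin 6 × Fin 6)
I-edges = (0F , 1F) ∷ (1F , 2F) ∷ (3F , 4F) ∷ (4F , 5F) ∷ (1F , 4F) ∷ []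

IAdj : Fin 6 → Fin 6 → Set
IAdj i j = ((i , j) ∈ I-edges) ⊎ ((j , i) ∈ I-edges)

P5-irrefl : ∀ {i} → ¬ P5Adj i i
P5-irrefl {i} (inj₁ e) = 1+n≢n (Eq.sym e)
P5-irrefl {i} (inj₂ e) = 1+n≢n (Eq.sym e)

P5 : Graph 5
P5 = record { Adj = P5Adj ; sym = swap ; irrefl = P5-irrefl }

I-noloop : ∀ {i} → ¬ ((i , i) ∈ I-edges)
I-noloop (here ())
I-noloop (there (here ()))
I-noloop (there (there (here ())))
I-noloop (there (there (there (here ()))))
I-noloop (there (there (there (there (here ())))))
I-noloop (there (there (there (there (there ())))))

I-irrefl : ∀ {i} → ¬ IAdj i i
I-irrefl (inj₁ m) = I-noloop m
I-irrefl (inj₂ m) = I-noloop m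

I-graph : Graph 6
I-graph = record { Adj = IAdj ; sym = swap ; irrefl = I-irrefl }

Colouring : ℕ → ℕ → Set
Colouring n k = Fin n → Fin k

Proper : ∀ {n k} → Graph n → Colouring n k → Set
Proper G c = ∀ u v → Adj G u v → c u ≢ c v

Strong : ∀ {n k} → Graph n → Colouring n k → Set
Strong {n} {k} G c = Proper G c × (∀ (a : Fin k) → ∃ λ v → c v ≡ a)

DifferOnOne : ∀ {n k} → Colouring n k → Colouring n k → Set
DifferOnOne {n} c d = ∃ λ (v : Fin n) → c v ≢ d v × (∀ w → w ≢ v → c w ≡ d w)

-- walks in S_k(G): every colouring visited is a strong k-colouring.
-- Colourings are functions, so the trivial walk is taken up to pointwise
-- equality (without function extensionality).
data SWalk {n k : ℕ} (G : Graph n) : Colouring n k → Colouring n k → Set where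
  done : ∀ {c d} → (∀ v → c v ≡ d v) → SWalk G c d
  step : ∀ {c e d} → Strong G e → DifferOnOne c e → SWalk G e d → SWalk G c d

SConnected : ∀ {n} → ℕ → Graph n → Set
SConnected {n} k G =
  ∀ (c d : Colouring n k) → Strong G c → Strong G d → SWalk G c d

-- If T contains P₅ or I, start from that copy: S₃(P₅) and S₃(I) are connected, as checked by
-- exhibiting a recolouring route from each of their strong colourings to a fixed one. The tree is
-- then grown leaf by leaf, and connectivity survives the addition of a leaf v with neighbour p:
-- a walk on the old vertices is replayed, recolouring v beforehand whenever the next step would
-- give p the colour of v. A strong colouring of the larger tree may miss a colour on the old part,
-- which is then properly 2-coloured; the two ends of a path of length two in it share a colour, so
-- recolouring one of them (not p) with the missing colour restores strongness in one step.
--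
-- Conversely, take a strong colouring c. A walk in S₃(T) from c to its colour rotation recolours
-- every vertex x at some step, and at that moment both the old and the new colour of x occur
-- elsewhere; so every vertex has two distinct vertices at distance at least two. In a tree this
-- forces a copy of P₅ or of I, found by extending a path on four vertices at both inner vertices.

module Submission where

open import Defs
open import Data.Bool using (Bool; true; T; not; _∧_; if_then_else_)
open import Data.Bool.Properties using (T-∧)
open import Data.Bool.ListAction using (all; any)
open import Data.Empty using (⊥-elim)
open import Data.Fin using (Fin; zero; suc; toℕ; _≟_)
open import Data.Fin.Patterns
import Data.Fin.Properties as Finₚ
open import Data.List using (List; []; _∷_; map; allFin; lookup; length; foldl; cartesianProduct)
open import Data.List.Properties using (length-removeAt′)
open import Data.List.Membership.Propositional using (_∈_; _∉_; find; lose)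
open import Data.List.Membership.Propositional.Properties using (∈-allFin; ∈-lookup; ∈-map⁺; ∈-map⁻)
import Data.List.Membership.DecPropositional as DecMembership
open import Data.List.Relation.Unary.All as All using (All; []; _∷_)
open import Data.List.Relation.Unary.All.Properties using (¬Any⇒All¬; ¬All⇒Any¬; all⁺; all⁻)
open import Data.List.Relation.Unary.AllPairs as AllPairs using (AllPairs; []; _∷_)
import Data.List.Relation.Unary.AllPairs.Properties as AllPairsₚ
open import Data.List.Relation.Unary.Any as Any using (here; there; _─_; index; satisfied)
open import Data.List.Relation.Unary.Any.Properties using (any⁺; any⁻)
open import Data.Nat using (ℕ; zero; suc; _^_; _≤_; s≤s)
open import Data.Nat.Properties using (suc-injective; 0≢1+n)
open import Data.Product using (Σ; ∃; ∃₂; _×_; _,_; proj₁; proj₂; uncurry)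
open import Data.Sum as Sum using (_⊎_; inj₁; inj₂; [_,_]′)
open import Data.Unit using (⊤; tt)
open import Data.Vec as Vec using (Vec; []; _∷_)
open import Data.Vec.Properties using (lookup∘tabulate)
open import Data.Vec.Functional using (updateAt; fromList)
open import Data.Vec.Functional.Properties using (updateAt-updates; updateAt-minimal)
open import Function using (_∘_; const; Equivalence)
open import Function.Definitions using (Injective)
open import Relation.Binary.PropositionalEquality as ≡ using (_≡_; _≢_; refl; cong; subst; trans)
open import Relation.Nullary using (¬_; yes; no; ¬?; _→-dec_; _⊎-dec_)
open import Relation.Nullary.Decidable using (⌊_⌋; toWitness; fromWitness; toWitnessFalse; fromWitnessFalse)

fresh-colour : (a b : Fin 3) → ∃ λ y → y ≢ a × y ≢ b
fresh-colour 0F 0F = 1F , (λ ()) , (λ ())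
fresh-colour 0F 1F = 2F , (λ ()) , (λ ())
fresh-colour 0F 2F = 1F , (λ ()) , (λ ())
fresh-colour 1F 0F = 2F , (λ ()) , (λ ())
fresh-colour 1F 1F = 0F , (λ ()) , (λ ())
fresh-colour 1F 2F = 0F , (λ ()) , (λ ())
fresh-colour 2F 0F = 1F , (λ ()) , (λ ())
fresh-colour 2F 1F = 0F , (λ ()) , (λ ())
fresh-colour 2F 2F = 0F , (λ ()) , (λ ())

-- Opaque: case analysis on its result would otherwise unfold the decision procedure.
opaque
  cover₃ : ∀ (a b c x : Fin 3) → a ≢ b → a ≢ c → b ≢ c → x ≡ a ⊎ x ≡ b ⊎ x ≡ c
  cover₃ = toWitness {a? = Finₚ.all? λ a → Finₚ.all? λ b → Finₚ.all? λ c → Finₚ.all? λ x →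
    ¬? (a ≟ b) →-dec ¬? (a ≟ c) →-dec ¬? (b ≟ c) →-dec (x ≟ a ⊎-dec x ≟ b ⊎-dec x ≟ c)} _

exhaust₃ : ∀ {a b c x : Fin 3} → a ≢ b → a ≢ c → b ≢ c → x ≢ a → x ≢ b → x ≡ c
exhaust₃ {a} {b} {c} {x} a≢b a≢c b≢c x≢a x≢b with cover₃ a b c x a≢b a≢c b≢c
... | inj₁ x≡a = ⊥-elim (x≢a x≡a)
... | inj₂ (inj₁ x≡b) = ⊥-elim (x≢b x≡b)
... | inj₂ (inj₂ x≡c) = x≡c

rot : Fin 3 → Fin 3
rot 0F = 1F
rot 1F = 2F
rot 2F = 0F

rot³ : ∀ a → rot (rot (rot a)) ≡ a
rot³ 0F = refl
rot³ 1F = refl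
rot³ 2F = refl

rot-injective : ∀ {a b} → rot a ≡ rot b → a ≡ b
rot-injective {a} {b} eq = trans (≡.sym (rot³ a)) (trans (cong (rot ∘ rot) eq) (rot³ b))

rot-moves : ∀ a → rot a ≢ a
rot-moves 0F ()
rot-moves 1F ()
rot-moves 2F ()

lookup-injective : ∀ {A : Set} {xs : List A} → AllPairs _≢_ xs → Injective _≡_ _≡_ (lookup xs)
lookup-injective {xs = _ ∷ _}  (_ ∷ _)        {zero}  {zero}  _ = refl
lookup-injective {xs = _ ∷ xs} (x∉xs ∷ _)     {zero}  {suc j} e = ⊥-elim (All.lookup x∉xs (∈-lookup {xs = xs} j) e)
lookup-injective {xs = _ ∷ xs} (x∉xs ∷ _)     {suc i} {zero}  e =
  ⊥-elim (All.lookup x∉xs (∈-lookup {xs = xs} i) (≡.sym e))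
lookup-injective {xs = _ ∷ _}  (_ ∷ distinct) {suc i} {suc j} e = cong suc (lookup-injective distinct e)

last-∈ : ∀ {A : Set} (x : A) xs → last x xs ∈ x ∷ xs
last-∈ x [] = here refl
last-∈ x (y ∷ ys) = there (last-∈ y ys)

∈-─ : ∀ {A : Set} {v w : A} {U} (v∈U : v ∈ U) → w ∈ U → w ≢ v → w ∈ (U ─ v∈U)
∈-─ (here refl) (here refl) w≢v = ⊥-elim (w≢v refl)
∈-─ (here _) (there w∈) _ = w∈
∈-─ (there _) (here refl) _ = here refl
∈-─ (there v∈) (there w∈) w≢v = there (∈-─ v∈ w∈ w≢v)

NoBacktrack : ∀ {A : Set} → List A → Set
NoBacktrack (x ∷ y ∷ z ∷ zs) = x ≢ z × NoBacktrack (y ∷ z ∷ zs)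
NoBacktrack _ = ⊤

path-map : ∀ {k n} {H : Graph k} {G : Graph n} (f : Fin k → Fin n) →
           (∀ i j → Adj H i j → Adj G (f i) (f j)) → ∀ {xs} → IsPath H xs → IsPath G (map f xs)
path-map f hom (single x) = single (f x)
path-map f hom (cons e p) = cons (hom _ _ e) (path-map f hom p)

⊆G-from-edges : ∀ {k n} (H : Graph k) (G : Graph n) (E : List (Fin k × Fin k)) →
                (∀ {i j} → Adj H i j → (i , j) ∈ E ⊎ (j , i) ∈ E) →
                (f : Fin k → Fin n) → Injective _≡_ _≡_ f →
                (∀ {i j} → (i , j) ∈ E → Adj G (f i) (f j)) → H ⊆G G
⊆G-from-edges H G E listed f f-inj edge = f , f-inj , λ i j i∼j → [ edge , sym G ∘ edge ]′ (listed i∼j)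

-- Walks in graphs and forests

data WalkIn {n : ℕ} (G : Graph n) (P : Fin n → Set) : Fin n → Fin n → Set where
  [_]    : ∀ {u} → P u → WalkIn G P u u
  _∷⟨_⟩_ : ∀ {u w v} → P u → Adj G u w → WalkIn G P w v → WalkIn G P u v

module Walks {n : ℕ} (G : Graph n) where
  open DecMembership (_≟_ {n}) using (_∈?_)

  module _ {P : Fin n → Set} where

    after : ∀ {u v} → WalkIn G P u v → List (Fin n)
    after [ _ ] = []
    after (_∷⟨_⟩_ {w = x} _ _ w) = x ∷ after w

    vertices : ∀ {u v} → WalkIn G P u v → List (Fin n)
    vertices {u} w = u ∷ after w

    Distinct : ∀ {u v} → WalkIn G P u v → Set
    Distinct w = AllPairs _≢_ (vertices w)

    walk-isPath : ∀ {u v} (w : WalkIn G P u v) → IsPath G (vertices w)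
    walk-isPath [ _ ] = single _
    walk-isPath (_ ∷⟨ e ⟩ w) = cons e (walk-isPath w)

    last-vertex : ∀ {u v} (w : WalkIn G P u v) → last u (after w) ≡ v
    last-vertex [ _ ] = refl
    last-vertex (_ ∷⟨ _ ⟩ w) = last-vertex w

    walk-inside : ∀ {u v} (w : WalkIn G P u v) → All P (vertices w)
    walk-inside [ p ] = p ∷ []
    walk-inside (p ∷⟨ _ ⟩ w) = p ∷ walk-inside w

    start-inside : ∀ {u v} → WalkIn G P u v → P u
    start-inside [ p ] = p
    start-inside (p ∷⟨ _ ⟩ _) = p

    _++ʷ_ : ∀ {u v t} → WalkIn G P u v → WalkIn G P v t → WalkIn G P u t
    [ _ ] ++ʷ w′ = w′
    (p ∷⟨ e ⟩ w) ++ʷ w′ = p ∷⟨ e ⟩ (w ++ʷ w′)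

    reverse : ∀ {u v} → WalkIn G P u v → WalkIn G P v u
    reverse w = go w [ start-inside w ]
      where
      go : ∀ {u v t} → WalkIn G P u v → WalkIn G P u t → WalkIn G P v t
      go [ _ ] acc = acc
      go (_ ∷⟨ e ⟩ w) acc = go w (start-inside w ∷⟨ sym G e ⟩ acc)

    suffix : ∀ {u v x} (w : WalkIn G P u v) → x ∈ vertices w →
             Σ (WalkIn G P x v) λ w′ → Distinct w → Distinct w′
    suffix w (here refl) = w , λ d → d
    suffix [ _ ] (there ())
    suffix (_ ∷⟨ _ ⟩ w) (there x∈) with suffix w x∈
    ... | w′ , keep = w′ , λ { (_ ∷ d) → keep d }

    shortcut : ∀ {u v} → WalkIn G P u v → Σ (WalkIn G P u v) Distinct
    shortcut [ p ] = [ p ] , [] ∷ []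
    shortcut (_∷⟨_⟩_ {u} p e w) with shortcut w
    ... | w′ , d with u ∈? vertices w′
    ...   | yes u∈ = suffix w′ u∈ .proj₁ , suffix w′ u∈ .proj₂ d
    ...   | no u∉ = (p ∷⟨ e ⟩ w′) , ¬Any⇒All¬ (vertices w′) u∉ ∷ d

  mapᴾ : ∀ {P Q : Fin n → Set} → (∀ {x} → P x → Q x) → ∀ {u v} → WalkIn G P u v → WalkIn G Q u v
  mapᴾ f [ p ] = [ f p ]
  mapᴾ f (p ∷⟨ e ⟩ w) = f p ∷⟨ e ⟩ mapᴾ f w

  toWalk : ∀ {P u v} → WalkIn G P u v → Walk G u v
  toWalk [ _ ] = here
  toWalk (_ ∷⟨ e ⟩ w) = step e (toWalk w)

  fromWalk : ∀ {u v} → Walk G u v → WalkIn G (λ _ → ⊤) u v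
  fromWalk here = [ tt ]
  fromWalk (step e w) = tt ∷⟨ e ⟩ fromWalk w

connected-via-root : ∀ {k} {H : Graph k} r → (∀ i → Walk H i r) → Connected H
connected-via-root {H = H} r to-r i j = toWalk (fromWalk (to-r i) ++ʷ reverse (fromWalk (to-r j)))
  where open Walks H

module Forest {n : ℕ} (G : Graph n) (acyclic : ¬ HasCycle G) where

  private
    upTo : ∀ {y} x xs → y ∈ x ∷ xs → List (Fin n)
    upTo x xs (here _) = []
    upTo x (x′ ∷ xs) (there y∈) = x′ ∷ upTo x′ xs y∈

    upTo-path : ∀ {y x xs} (y∈ : y ∈ x ∷ xs) → IsPath G (x ∷ xs) → IsPath G (x ∷ upTo x xs y∈)
    upTo-path (here _) _ = single _
    upTo-path (there y∈) (cons e p) = cons e (upTo-path y∈ p)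

    upTo-All : ∀ {P : Fin n → Set} {y x xs} (y∈ : y ∈ x ∷ xs) → All P xs → All P (upTo x xs y∈)
    upTo-All (here _) _ = []
    upTo-All (there y∈) (px ∷ pxs) = px ∷ upTo-All y∈ pxs

    upTo-distinct : ∀ {y x xs} (y∈ : y ∈ x ∷ xs) → AllPairs _≢_ (x ∷ xs) →
                    AllPairs _≢_ (x ∷ upTo x xs y∈)
    upTo-distinct (here _) _ = [] ∷ []
    upTo-distinct {x = x} {xs = _ ∷ _} (there y∈) (x∉ ∷ d) =
      upTo-All {x = x} (there y∈) x∉ ∷ upTo-distinct y∈ d

    upTo-last : ∀ {y x xs} (y∈ : y ∈ x ∷ xs) → last x (upTo x xs y∈) ≡ y
    upTo-last (here refl) = refl
    upTo-last {xs = _ ∷ _} (there y∈) = upTo-last y∈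

  -- The segment of the path from x₀ to y, closed by the edge y x₀, would be a cycle.
  no-chord : ∀ {x₀ x₁ xs y} → IsPath G (x₀ ∷ x₁ ∷ xs) → AllPairs _≢_ (x₀ ∷ x₁ ∷ xs) → y ∈ xs →
             ¬ Adj G y x₀
  no-chord {xs = []} _ _ ()
  no-chord {x₀} {x₁} {x₂ ∷ xs} p d y∈ e =
    acyclic (x₀ , x₁ , x₂ , upTo x₂ xs y∈ , upTo-path (there (there y∈)) p ,
             upTo-distinct (there (there y∈)) d , subst (λ z → Adj G z x₀) (≡.sym (upTo-last y∈)) e)

  nonbacktracking-distinct : ∀ {xs} → IsPath G xs → NoBacktrack xs → AllPairs _≢_ xs
  nonbacktracking-distinct (single x) _ = [] ∷ []
  nonbacktracking-distinct (cons e p) nb = fresh e p rest nb ∷ rest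
    where
    tail-nb : ∀ {y xs} → IsPath G xs → NoBacktrack (y ∷ xs) → NoBacktrack xs
    tail-nb (single _) _ = tt
    tail-nb (cons _ _) (_ , nb) = nb
    rest = nonbacktracking-distinct p (tail-nb p nb)
    loopless : ∀ {y x} → Adj G y x → y ≢ x
    loopless e refl = irrefl G e
    fresh : ∀ {y x xs} → Adj G y x → IsPath G (x ∷ xs) → AllPairs _≢_ (x ∷ xs) → NoBacktrack (y ∷ x ∷ xs) →
            All (y ≢_) (x ∷ xs)
    fresh e (single _) _ _ = loopless e ∷ []
    fresh e p@(cons _ _) d (y≢x₁ , _) =
      loopless e ∷ y≢x₁ ∷ All.tabulate (λ z∈ y≡z → no-chord p d (subst (_∈ _) (≡.sym y≡z) z∈) e)

  embedding-induced : ∀ {k} {H : Graph k} → Connected H → (f : Fin k → Fin n) → Injective _≡_ _≡_ f →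
                      (∀ i j → Adj H i j → Adj G (f i) (f j)) → ∀ i j → Adj G (f i) (f j) → Adj H i j
  embedding-induced {H = H} conn f f-inj hom i j e with Walks.shortcut H (Walks.fromWalk H (conn i j))
  ... | [ _ ] , _ = ⊥-elim (irrefl G e)
  ... | _ ∷⟨ a ⟩ [ _ ] , _ = a
  ... | _ ∷⟨ a ⟩ (_∷⟨_⟩_ {w = y} _ b w) , d =
        ⊥-elim (no-chord (path-map f hom (walk-isPath (_ ∷⟨ a ⟩ (_ ∷⟨ b ⟩ w))))
                         (AllPairsₚ.map⁺ (AllPairs.map (λ ne → ne ∘ f-inj) d))
                         (∈-map⁺ f (subst (_∈ y ∷ after w) (last-vertex w) (last-∈ y (after w))))
                         (sym G e))
    where open Walks H

-- Strong colourings on a list of vertices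

recolour : ∀ {n} → Colouring n 3 → Fin n → Fin 3 → Colouring n 3
recolour c v x = updateAt c v (const x)

recolour-same : ∀ {n} (c : Colouring n 3) v x → recolour c v x v ≡ x
recolour-same c v x = updateAt-updates v c

recolour-other : ∀ {n} (c : Colouring n 3) {v} x {w} → w ≢ v → recolour c v x w ≡ c w
recolour-other c {v} x {w} w≢v = updateAt-minimal w v c w≢v

module Colourings {n : ℕ} (G : Graph n) where

  ProperOn : List (Fin n) → Colouring n 3 → Set
  ProperOn S c = ∀ u v → u ∈ S → v ∈ S → Adj G u v → c u ≢ c v

  OntoOn : List (Fin n) → Colouring n 3 → Set
  OntoOn S c = ∀ a → ∃ λ v → v ∈ S × c v ≡ a

  StrongOn : List (Fin n) → Colouring n 3 → Set
  StrongOn S c = ProperOn S c × OntoOn S c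

  _≈[_]_ : Colouring n 3 → List (Fin n) → Colouring n 3 → Set
  c ≈[ S ] d = ∀ s → s ∈ S → c s ≡ d s

  DifferOnOneIn : List (Fin n) → Colouring n 3 → Colouring n 3 → Set
  DifferOnOneIn S c d = ∃ λ v → v ∈ S × c v ≢ d v × (∀ w → w ∈ S → w ≢ v → c w ≡ d w)

  data SWalkOn (S : List (Fin n)) : Colouring n 3 → Colouring n 3 → Set where
    done : ∀ {c d} → c ≈[ S ] d → SWalkOn S c d
    move : ∀ {c e d} → StrongOn S e → DifferOnOneIn S c e → SWalkOn S e d → SWalkOn S c d

  SConnectedOn : List (Fin n) → Set
  SConnectedOn S = ∀ c d → StrongOn S c → StrongOn S d → SWalkOn S c d

  module _ {S : List (Fin n)} where

    onto-resp : ∀ {c d} → c ≈[ S ] d → OntoOn S c → OntoOn S d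
    onto-resp c≈d onto a with onto a
    ... | w , w∈ , cw≡a = w , w∈ , trans (≡.sym (c≈d w w∈)) cw≡a

    SWalkOn-from : ∀ {c c′ d} → c ≈[ S ] c′ → SWalkOn S c d → SWalkOn S c′ d
    SWalkOn-from c≈c′ (done c≈d) = done (λ s s∈ → trans (≡.sym (c≈c′ s s∈)) (c≈d s s∈))
    SWalkOn-from c≈c′ (move se (u , u∈ , cu≢eu , same) w) =
      move se (u , u∈ , (λ c′u≡eu → cu≢eu (trans (c≈c′ u u∈) c′u≡eu)) ,
               (λ x x∈ x≢u → trans (≡.sym (c≈c′ x x∈)) (same x x∈ x≢u))) w

    infixr 5 _▸_
    _▸_ : ∀ {c d e} → SWalkOn S c d → SWalkOn S d e → SWalkOn S c e
    done c≈d ▸ w = SWalkOn-from (λ s s∈ → ≡.sym (c≈d s s∈)) w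
    move se diff w ▸ w′ = move se diff (w ▸ w′)

    one-move : ∀ {c e} → StrongOn S e → DifferOnOneIn S c e → SWalkOn S c e
    one-move se diff = move se diff (done (λ _ _ → refl))

    SWalkOn-reverse : ∀ {c d} → StrongOn S c → SWalkOn S c d → SWalkOn S d c
    SWalkOn-reverse sc w = go sc w (done (λ _ _ → refl))
      where
      flip-diff : ∀ {c e} → DifferOnOneIn S c e → DifferOnOneIn S e c
      flip-diff (u , u∈ , ne , same) = u , u∈ , (ne ∘ ≡.sym) , (λ x x∈ x≢u → ≡.sym (same x x∈ x≢u))
      go : ∀ {c d b} → StrongOn S c → SWalkOn S c d → SWalkOn S c b → SWalkOn S d b
      go _ (done c≈d) acc = SWalkOn-from c≈d acc
      go sc (move se diff w) acc = go se w (move sc (flip-diff diff) acc)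

    onto-or-missing : ∀ c → OntoOn S c ⊎ ∃ λ z → ∀ s → s ∈ S → c s ≢ z
    onto-or-missing c with Finₚ.all? (λ a → Any.any? (λ s → c s ≟ a) S)
    ... | yes onto = inj₁ (λ a → find (onto a))
    ... | no ¬onto with Finₚ.¬∀⟶∃¬ 3 _ (λ a → Any.any? (λ s → c s ≟ a) S) ¬onto
    ...   | z , ¬any = inj₂ (z , λ s s∈ cs≡z → ¬any (lose s∈ cs≡z))

    proper-recolour : ∀ {c q z} → ProperOn S c → (∀ b → b ∈ S → Adj G q b → c b ≢ z) →
                      ProperOn S (recolour c q z)
    proper-recolour {c} {q} {z} pc free a b a∈ b∈ e with a ≟ q | b ≟ q
    ... | yes refl | yes refl = ⊥-elim (irrefl G e)
    ... | yes refl | no b≢q = λ eq →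
      free b b∈ e (≡.sym (trans (≡.sym (recolour-same c q z)) (trans eq (recolour-other c z b≢q))))
    ... | no a≢q | yes refl = λ eq →
      free a a∈ (sym G e) (trans (≡.sym (recolour-other c z a≢q)) (trans eq (recolour-same c q z)))
    ... | no a≢q | no b≢q = λ eq →
      pc a b a∈ b∈ e (trans (≡.sym (recolour-other c z a≢q)) (trans eq (recolour-other c z b≢q)))

  SWalkOn⇒SWalk : ∀ {S c d} → (∀ w → w ∈ S) → SWalkOn S c d → SWalk G c d
  SWalkOn⇒SWalk all∈ (done c≈d) = done (λ w → c≈d w (all∈ w))
  SWalkOn⇒SWalk all∈ (move (pe , oe) (u , _ , ne , same) w) =
    step ((λ a b → pe a b (all∈ a) (all∈ b)) , (λ a → proj₁ (oe a) , proj₂ (proj₂ (oe a))))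
         (u , ne , (λ x → same x (all∈ x))) (SWalkOn⇒SWalk all∈ w)

  Strong⇒StrongOn : ∀ {S c} → (∀ w → w ∈ S) → Strong G c → StrongOn S c
  Strong⇒StrongOn all∈ (pc , onto) = (λ a b _ _ → pc a b) , (λ a → proj₁ (onto a) , all∈ _ , proj₂ (onto a))

  StrongOn⇒Strong : ∀ {S c} → (∀ w → w ∈ S) → StrongOn S c → Strong G c
  StrongOn⇒Strong all∈ (pc , onto) =
    (λ a b → pc a b (all∈ a) (all∈ b)) , (λ a → proj₁ (onto a) , proj₂ (proj₂ (onto a)))

  strong-resp : ∀ {c d : Colouring n 3} → (∀ w → c w ≡ d w) → Strong G c → Strong G d
  strong-resp c≗d (pc , onto) =
    (λ u v e eq → pc u v e (trans (c≗d u) (trans eq (≡.sym (c≗d v))))) ,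
    (λ a → proj₁ (onto a) , trans (≡.sym (c≗d (proj₁ (onto a)))) (proj₂ (onto a)))

  covering-connected : ∀ {S} → (∀ w → w ∈ S) → SConnectedOn S → SConnected 3 G
  covering-connected all∈ conn c d sc sd =
    SWalkOn⇒SWalk all∈ (conn c d (Strong⇒StrongOn all∈ sc) (Strong⇒StrongOn all∈ sd))

  record Pendant (S : List (Fin n)) (v : Fin n) : Set where
    field
      anchor   : Fin n
      outside  : v ∉ S
      anchor∈  : anchor ∈ S
      to-anchor : Adj G v anchor
      unique   : ∀ s → s ∈ S → Adj G v s → s ≡ anchor

  record Cherry (S : List (Fin n)) : Set where
    field
      x m y   : Fin n
      x∈      : x ∈ S
      m∈      : m ∈ S
      y∈      : y ∈ S
      x∼m     : Adj G x m
      y∼m     : Adj G y m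
      x≢y     : x ≢ y

  cherry-∷ : ∀ {S} v → Cherry S → Cherry (v ∷ S)
  cherry-∷ v ch = record { Cherry ch ; x∈ = there x∈ ; m∈ = there m∈ ; y∈ = there y∈ }
    where open Cherry ch

  module LeafExtension {S : List (Fin n)} {v : Fin n} (pendant : Pendant S v) where
    open Pendant pendant renaming (anchor to p)

    ≢leaf : ∀ {s} → s ∈ S → s ≢ v
    ≢leaf s∈ refl = outside s∈

    recolour-≈ : ∀ c x → c ≈[ S ] recolour c v x
    recolour-≈ c x s s∈ = ≡.sym (recolour-other c x (≢leaf s∈))

    onto-∷ : ∀ {c} → OntoOn S c → OntoOn (v ∷ S) c
    onto-∷ onto a with onto a
    ... | w , w∈ , cw≡a = w , there w∈ , cw≡a

    proper-leaf : ∀ {e e′} → ProperOn S e → e ≈[ S ] e′ → e′ v ≢ e p → ProperOn (v ∷ S) e′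
    proper-leaf pe e≈e′ fresh a b (here refl) (here refl) e = ⊥-elim (irrefl G e)
    proper-leaf pe e≈e′ fresh a b (here refl) (there b∈) e with unique b b∈ e
    ... | refl = λ eq → fresh (trans eq (≡.sym (e≈e′ p anchor∈)))
    proper-leaf pe e≈e′ fresh a b (there a∈) (here refl) e with unique a a∈ (sym G e)
    ... | refl = λ eq → fresh (≡.sym (trans (e≈e′ p anchor∈) eq))
    proper-leaf pe e≈e′ fresh a b (there a∈) (there b∈) e eq =
      pe a b a∈ b∈ e (trans (e≈e′ a a∈) (trans eq (≡.sym (e≈e′ b b∈))))

    strong-leaf : ∀ {e e′} → StrongOn S e → e ≈[ S ] e′ → e′ v ≢ e p → StrongOn (v ∷ S) e′
    strong-leaf (pe , oe) e≈e′ fresh = proper-leaf pe e≈e′ fresh , onto-∷ (onto-resp e≈e′ oe)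

    differ-leaf : ∀ {c c′ e e′} → c ≈[ S ] c′ → DifferOnOneIn S c e → e ≈[ S ] e′ → c′ v ≡ e′ v →
                  DifferOnOneIn (v ∷ S) c′ e′
    differ-leaf c≈c′ (u , u∈ , cu≢eu , same) e≈e′ at-v =
      u , there u∈ , (λ eq → cu≢eu (trans (c≈c′ u u∈) (trans eq (≡.sym (e≈e′ u u∈))))) ,
      λ { w (here refl) _ → at-v
        ; w (there w∈) w≢u → trans (≡.sym (c≈c′ w w∈)) (trans (same w w∈ w≢u) (e≈e′ w w∈)) }

    differ-at-leaf : ∀ {c d} → c ≈[ S ] d → c v ≢ d v → DifferOnOneIn (v ∷ S) c d
    differ-at-leaf c≈d ne = v , here refl , ne ,
      λ { w (here refl) w≢v → ⊥-elim (w≢v refl) ; w (there w∈) _ → c≈d w w∈ }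

    -- The step at u is copied, after first moving v out of the way if e p would clash with it.
    lift-step : ∀ {c c′ e} → StrongOn S c → StrongOn S e → DifferOnOneIn S c e →
                ProperOn (v ∷ S) c′ → c ≈[ S ] c′ →
                ∃ λ e′ → SWalkOn (v ∷ S) c′ e′ × e ≈[ S ] e′ × ProperOn (v ∷ S) e′
    lift-step {c} {c′} {e} sc se diff pc′ c≈c′ with e p ≟ c′ v
    ... | no ep≢c′v = e′ , one-move se′ c′→e′ , e≈e′ , proj₁ se′
      where
      e′ = recolour e v (c′ v)
      e≈e′ = recolour-≈ e (c′ v)
      se′ = strong-leaf se e≈e′ (λ eq → ep≢c′v (trans (≡.sym eq) (recolour-same e v (c′ v))))
      c′→e′ : DifferOnOneIn (v ∷ S) c′ e′
      c′→e′ = differ-leaf c≈c′ diff e≈e′ (≡.sym (recolour-same e v (c′ v)))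
    ... | yes ep≡c′v with fresh-colour (c′ v) (c p)
    ...   | y , y≢c′v , y≢cp = e′ , one-move sc″ c′→c″ ▸ one-move se′ c″→e′ , e≈e′ , proj₁ se′
      where
      c″ = recolour c′ v y
      e′ = recolour e v y
      e≈e′ = recolour-≈ e y
      c≈c″ : c ≈[ S ] c″
      c≈c″ s s∈ = trans (c≈c′ s s∈) (recolour-≈ c′ y s s∈)
      sc″ = strong-leaf sc c≈c″ (λ eq → y≢cp (trans (≡.sym (recolour-same c′ v y)) eq))
      se′ = strong-leaf se e≈e′ (λ eq → y≢c′v (trans (≡.sym (recolour-same e v y)) (trans eq ep≡c′v)))
      c′→c″ : DifferOnOneIn (v ∷ S) c′ c″
      c′→c″ = differ-at-leaf (recolour-≈ c′ y) (λ eq → y≢c′v (≡.sym (trans eq (recolour-same c′ v y))))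
      c″→e′ : DifferOnOneIn (v ∷ S) c″ e′
      c″→e′ = differ-leaf c≈c″ diff e≈e′ (trans (recolour-same c′ v y) (≡.sym (recolour-same e v y)))

    lift : ∀ {c c′ d} → StrongOn S c → SWalkOn S c d → ProperOn (v ∷ S) c′ → c ≈[ S ] c′ →
           ∃ λ d′ → SWalkOn (v ∷ S) c′ d′ × d ≈[ S ] d′ × ProperOn (v ∷ S) d′
    lift _ (done c≈d) pc′ c≈c′ =
      _ , done (λ _ _ → refl) , (λ s s∈ → trans (≡.sym (c≈d s s∈)) (c≈c′ s s∈)) , pc′
    lift sc (move se diff rest) pc′ c≈c′ with lift-step sc se diff pc′ c≈c′
    ... | e′ , c′↝e′ , e≈e′ , pe′ with lift se rest pe′ e≈e′
    ...   | d′ , e′↝d′ , d≈d′ , pd′ = d′ , c′↝e′ ▸ e′↝d′ , d≈d′ , pd′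

    -- On S a proper colouring missing z is a proper 2-colouring, so the two ends of a cherry
    -- share a colour; recolouring one end (not the anchor) with z makes S use all three colours.
    recolour-twin : ∀ {c z q r m} → ProperOn (v ∷ S) c → (∀ s → s ∈ S → c s ≢ z) →
                    q ∈ S → r ∈ S → m ∈ S → q ≢ p → r ≢ q → Adj G q m → Adj G r m →
                    ∃ λ c₀ → SWalkOn (v ∷ S) c c₀ × OntoOn S c₀ × ProperOn (v ∷ S) c₀
    recolour-twin {c} {z} {q} {r} {m} pc missing q∈ r∈ m∈ q≢p r≢q q∼m r∼m =
      c₀ , one-move (pc₀ , onto-∷ onto₀) differ , onto₀ , pc₀
      where
      c₀ = recolour c q z
      pc₀ : ProperOn (v ∷ S) c₀
      pc₀ = proper-recolour pc λ { b (here refl) e → ⊥-elim (q≢p (unique q q∈ (sym G e)))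
                                 ; b (there b∈) _ → missing b b∈ }
      cq≢cm = pc q m (there q∈) (there m∈) q∼m
      cq≢z = missing q q∈
      cm≢z = missing m m∈
      cr≡cq : c r ≡ c q
      cr≡cq = exhaust₃ cm≢z (cq≢cm ∘ ≡.sym) (cq≢z ∘ ≡.sym) (pc r m (there r∈) (there m∈) r∼m) (missing r r∈)
      m≢q : m ≢ q
      m≢q refl = irrefl G q∼m
      onto₀ : OntoOn S c₀
      onto₀ a with cover₃ z (c q) (c m) a (cq≢z ∘ ≡.sym) (cm≢z ∘ ≡.sym) cq≢cm
      ... | inj₁ refl = q , q∈ , recolour-same c q z
      ... | inj₂ (inj₁ refl) = r , r∈ , trans (recolour-other c z r≢q) cr≡cq
      ... | inj₂ (inj₂ refl) = m , m∈ , recolour-other c z m≢q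
      differ : DifferOnOneIn (v ∷ S) c c₀
      differ = q , there q∈ , (λ eq → cq≢z (trans eq (recolour-same c q z))) ,
               λ w _ w≢q → ≡.sym (recolour-other c z w≢q)

    make-onto : ∀ {c} → Cherry S → ProperOn (v ∷ S) c →
                ∃ λ c₀ → SWalkOn (v ∷ S) c c₀ × OntoOn S c₀ × ProperOn (v ∷ S) c₀
    make-onto {c} ch pc with onto-or-missing c | Cherry.x ch ≟ p
    ... | inj₁ onto | _ = c , done (λ _ _ → refl) , onto , pc
    ... | inj₂ (_ , missing) | yes x≡p =
      recolour-twin pc missing y∈ x∈ m∈ (λ y≡p → x≢y (trans x≡p (≡.sym y≡p))) x≢y y∼m x∼m
      where open Cherry ch
    ... | inj₂ (_ , missing) | no x≢p = recolour-twin pc missing x∈ y∈ m∈ x≢p (x≢y ∘ ≡.sym) x∼m y∼m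
      where open Cherry ch

    restrict : ∀ {e} → ProperOn (v ∷ S) e → ProperOn S e
    restrict pe a b a∈ b∈ = pe a b (there a∈) (there b∈)

    connected-∷ : Cherry S → SConnectedOn S → SConnectedOn (v ∷ S)
    connected-∷ ch conn c d (pc , _) sd@(pd , _) with make-onto ch pc | make-onto ch pd
    ... | c₀ , c↝c₀ , oc₀ , pc₀ | d₀ , d↝d₀ , od₀ , pd₀
      with lift (restrict pc₀ , oc₀) (conn c₀ d₀ (restrict pc₀ , oc₀) (restrict pd₀ , od₀)) pc₀ (λ _ _ → refl)
    ...   | d₁ , c₀↝d₁ , d₀≈d₁ , _ = c↝c₀ ▸ c₀↝d₁ ▸ d₁↝d₀ ▸ SWalkOn-reverse sd d↝d₀
      where
      d₁↝d₀ : SWalkOn (v ∷ S) d₁ d₀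
      d₁↝d₀ with d₁ v ≟ d₀ v
      ... | yes eq = done λ { s (here refl) → eq ; s (there s∈) → ≡.sym (d₀≈d₁ s s∈) }
      ... | no ne = one-move (pd₀ , onto-∷ od₀) (differ-at-leaf (λ s s∈ → ≡.sym (d₀≈d₁ s s∈)) ne)

-- Growing a subtree to the whole tree

module Growth {n : ℕ} (T : Graph n) (tree : IsTree T) where
  open Colourings T using (Pendant)
  open Walks T
  open Forest T (proj₂ tree)
  open DecMembership (_≟_ {n}) using (_∈?_)

  Rooted : List (Fin n) → Fin n → Set
  Rooted S r = r ∈ S × (∀ t → t ∈ S → WalkIn T (_∈ S) t r)

  private
    pendant-unique : ∀ {S r v p s} → Rooted S r → v ∉ S → p ∈ S → s ∈ S → Adj T v p → Adj T v s → s ≡ p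
    pendant-unique {S} {v = v} {p} {s} (_ , to-root) v∉ p∈ s∈ v∼p v∼s with s ≟ p
    ... | yes s≡p = s≡p
    ... | no s≢p with shortcut (to-root p p∈ ++ʷ reverse (to-root s s∈))
    ...   | [ _ ] , _ = ⊥-elim (s≢p refl)
    ...   | w@(_∷⟨_⟩_ {w = x} _ _ w′) , d =
            ⊥-elim (no-chord (cons v∼p (walk-isPath w)) (All.map outside (walk-inside w) ∷ d)
                             (subst (_∈ x ∷ after w′) (last-vertex w′) (last-∈ x (after w′))) (sym T v∼s))
      where
      outside : ∀ {t} → t ∈ S → v ≢ t
      outside t∈ refl = v∉ t∈

    exit-edge : ∀ {S r u} {Q : Fin n → Set} → r ∈ S → WalkIn T Q u r → u ∉ S →
                ∃₂ λ v p → v ∉ S × p ∈ S × Adj T v p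
    exit-edge r∈ [ _ ] u∉ = ⊥-elim (u∉ r∈)
    exit-edge {S} r∈ (_∷⟨_⟩_ {u} {x} _ u∼x w) u∉ with x ∈? S
    ... | yes x∈ = u , x , u∉ , x∈ , u∼x
    ... | no x∉ = exit-edge r∈ w x∉

  Spanning : (List (Fin n) → Set) → Set
  Spanning P = ∃ λ S → (∀ w → w ∈ S) × P S

  grow : (P : List (Fin n) → Set) → (∀ {S v} → Pendant S v → P S → P (v ∷ S)) →
         ∀ {S r} → Rooted S r → P S → Spanning P
  grow P add-leaf {r = r} rooted pS = go _ (allFin n) refl (λ w _ → ∈-allFin w) rooted pS
    where
    -- U holds every vertex outside S and loses the new leaf at each step.
    go : ∀ k {S} U → length U ≡ k → (∀ w → w ∉ S → w ∈ U) → Rooted S r → P S → Spanning P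
    go k {S} U len cover rooted pS with All.all? (_∈? S) (allFin n)
    ... | yes all∈ = S , (λ w → All.lookup all∈ (∈-allFin w)) , pS
    ... | no ¬all with find (¬All⇒Any¬ (_∈? S) _ ¬all)
    ...   | w , _ , w∉ with exit-edge (proj₁ rooted) (fromWalk (proj₁ tree w r)) w∉
    ...     | v , p , v∉ , p∈ , v∼p = next k len
      where
      v∈U = cover v v∉
      pendant : Pendant S v
      pendant = record { anchor = p ; outside = v∉ ; anchor∈ = p∈ ; to-anchor = v∼p
                       ; unique = λ s s∈ v∼s → pendant-unique rooted v∉ p∈ s∈ v∼p v∼s }
      rooted′ : Rooted (v ∷ S) r
      rooted′ = there (proj₁ rooted) ,
                λ { t (here refl) → here refl ∷⟨ v∼p ⟩ mapᴾ there (proj₂ rooted p p∈)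
                  ; t (there t∈) → mapᴾ there (proj₂ rooted t t∈) }
      cover′ : ∀ w → w ∉ v ∷ S → w ∈ (U ─ v∈U)
      cover′ w w∉ = ∈-─ v∈U (cover w (λ w∈ → w∉ (there w∈))) (λ w≡v → w∉ (here w≡v))
      next : ∀ k → length U ≡ k → Spanning P
      next zero len = ⊥-elim (0≢1+n (trans (≡.sym len) (length-removeAt′ U (index v∈U))))
      next (suc k) len = go k (U ─ v∈U) (suc-injective (trans (≡.sym (length-removeAt′ U _)) len))
                            cover′ rooted′ (add-leaf pendant pS)

-- Copies of a small graph; S₃(P₅) and S₃(I)

module Embedding {k n : ℕ} (f : Fin k → Fin n) (f-inj : Injective _≡_ _≡_ f) where

  image : List (Fin n)
  image = map f (allFin k)

  ∈-image : ∀ i → f i ∈ image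
  ∈-image i = ∈-map⁺ f (∈-allFin i)

  ∈-image⁻ : ∀ {w} → w ∈ image → ∃ λ i → w ≡ f i
  ∈-image⁻ w∈ with ∈-map⁻ f w∈
  ... | i , _ , w≡fi = i , w≡fi

  -- Colours off the image are irrelevant; 0F is a junk value there.
  push : Colouring k 3 → Colouring n 3
  push e w with Finₚ.any? (λ i → f i ≟ w)
  ... | yes (i , _) = e i
  ... | no _ = 0F

  push-image : ∀ e i → push e (f i) ≡ e i
  push-image e i with Finₚ.any? (λ j → f j ≟ f i)
  ... | yes (j , fj≡fi) = cong e (f-inj fj≡fi)
  ... | no ∄ = ⊥-elim (∄ (i , refl))

  module Image {H : Graph k} {G : Graph n} (hom : ∀ i j → Adj H i j → Adj G (f i) (f j))
               (induced : ∀ i j → Adj G (f i) (f j) → Adj H i j) where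
    open Colourings G

    walk-image : ∀ {P i j} → WalkIn H P i j → WalkIn G (_∈ image) (f i) (f j)
    walk-image [ _ ] = [ ∈-image _ ]
    walk-image (_ ∷⟨ e ⟩ w) = ∈-image _ ∷⟨ hom _ _ e ⟩ walk-image w

    strong-restrict : ∀ {c} → StrongOn image c → Strong H (λ i → c (f i))
    strong-restrict {c} (pc , onto) =
      (λ i j e → pc (f i) (f j) (∈-image i) (∈-image j) (hom i j e)) , onto′
      where
      onto′ : ∀ a → ∃ λ i → c (f i) ≡ a
      onto′ a with onto a
      ... | w , w∈ , cw≡a with ∈-image⁻ w∈
      ...   | i , refl = i , cw≡a

    strong-push : ∀ {e} → Strong H e → StrongOn image (push e)
    strong-push {e} (pe , onto) =
      proper , λ a → f (proj₁ (onto a)) , ∈-image _ , trans (push-image e _) (proj₂ (onto a))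
      where
      proper : ProperOn image (push e)
      proper u v u∈ v∈ with ∈-image⁻ u∈ | ∈-image⁻ v∈
      ... | i , refl | j , refl = λ adj eq →
        pe i j (induced i j adj) (trans (≡.sym (push-image e i)) (trans eq (push-image e j)))

    connected-image : SConnected 3 H → SConnectedOn image
    connected-image conn c d sc sd =
      pull (conn _ _ (strong-restrict sc) (strong-restrict sd)) (λ _ → refl) (λ _ → refl)
      where
      pull : ∀ {e₁ e₂ c d} → SWalk H e₁ e₂ → (∀ i → c (f i) ≡ e₁ i) → (∀ i → d (f i) ≡ e₂ i) →
             SWalkOn image c d
      pull {c = c} {d} (done e₁≗e₂) c≗ d≗ = done agree
        where
        agree : ∀ w → w ∈ image → c w ≡ d w
        agree w w∈ with ∈-image⁻ w∈
        ... | i , refl = trans (c≗ i) (trans (e₁≗e₂ i) (≡.sym (d≗ i)))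
      pull {c = c} (step {e = e} se (i , ne , same) w) c≗ d≗ =
        move (strong-push se) differ (pull w (push-image e) d≗)
        where
        differ : DifferOnOneIn image c (push e)
        differ = f i , ∈-image i , (λ eq → ne (trans (≡.sym (c≗ i)) (trans eq (push-image e i)))) , unchanged
          where
          unchanged : ∀ w → w ∈ image → w ≢ f i → c w ≡ push e w
          unchanged w w∈ w≢fi with ∈-image⁻ w∈
          ... | j , refl =
            trans (c≗ j) (trans (same j (λ j≡i → w≢fi (cong f j≡i))) (≡.sym (push-image e j)))

module Certificate {k : ℕ} (H : Graph k) (E : List (Fin k × Fin k))
                   (listed : ∀ {i j} → Adj H i j → (i , j) ∈ E ⊎ (j , i) ∈ E)
                   (edge : ∀ {i j} → (i , j) ∈ E → Adj H i j) where
  open Colourings H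

  edge-ok? : Colouring k 3 → Fin k × Fin k → Bool
  edge-ok? c (i , j) = not ⌊ c i ≟ c j ⌋

  colour-at? : Colouring k 3 → Fin 3 → Fin k → Bool
  colour-at? c a i = ⌊ c i ≟ a ⌋

  colour-used? : Colouring k 3 → Fin 3 → Bool
  colour-used? c a = any (colour-at? c a) (allFin k)

  strong? : Colouring k 3 → Bool
  strong? c = all (edge-ok? c) E ∧ all (colour-used? c) (allFin 3)

  strong?-sound : ∀ c → T (strong? c) → Strong H c
  strong?-sound c ok = proper , onto
    where
    split = Equivalence.to (T-∧ {all (edge-ok? c) E}) ok
    edges-ok = all⁺ (edge-ok? c) E (proj₁ split)
    colours-used = all⁺ (colour-used? c) (allFin 3) (proj₂ split)
    proper : Proper H c
    proper i j i∼j with listed i∼j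
    ... | inj₁ ij∈ = toWitnessFalse (All.lookup edges-ok ij∈)
    ... | inj₂ ji∈ = toWitnessFalse (All.lookup edges-ok ji∈) ∘ ≡.sym
    onto : ∀ a → ∃ λ i → c i ≡ a
    onto a with satisfied (any⁻ (colour-at? c a) (allFin k) (All.lookup colours-used (∈-allFin a)))
    ... | i , ci≟a = i , toWitness ci≟a

  strong?-complete : ∀ c → Strong H c → T (strong? c)
  strong?-complete c (proper , onto) = Equivalence.from (T-∧ {all (edge-ok? c) E})
    ( all⁻ (edge-ok? c) {xs = E} (All.tabulate λ { {i , j} ij∈ → fromWitnessFalse (proper i j (edge ij∈)) })
    , all⁻ (colour-used? c) {xs = allFin 3} (All.tabulate λ {a} _ → any⁺ (colour-at? c a) (used a)))
    where
    used : ∀ a → Any.Any (T ∘ colour-at? c a) (allFin k)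
    used a = lose (∈-allFin (proj₁ (onto a))) (fromWitness (proj₂ (onto a)))

  Move : Set
  Move = Fin k × Fin 3

  agree-at? : Colouring k 3 → Colouring k 3 → Fin k → Bool
  agree-at? c d i = ⌊ c i ≟ d i ⌋

  same? : Colouring k 3 → Colouring k 3 → Bool
  same? c d = all (agree-at? c d) (allFin k)

  leadsTo : Colouring k 3 → List Move → Colouring k 3 → Bool
  leadsTo c [] t = same? c t
  leadsTo c ((i , x) ∷ ms) t = not ⌊ c i ≟ x ⌋ ∧ (strong? (recolour c i x) ∧ leadsTo (recolour c i x) ms t)

  leadsTo-sound : ∀ c ms t → T (leadsTo c ms t) → SWalkOn (allFin k) c t
  leadsTo-sound c [] t ok =
    done λ i _ → toWitness (All.lookup (all⁺ (agree-at? c t) (allFin k) ok) (∈-allFin i))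
  leadsTo-sound c ((i , x) ∷ ms) t ok =
    move (Strong⇒StrongOn ∈-allFin (strong?-sound _ (proj₁ rest)))
         (i , ∈-allFin i , (λ eq → toWitnessFalse (proj₁ split) (trans eq (recolour-same c i x))) ,
          λ w _ w≢i → ≡.sym (recolour-other c x w≢i))
         (leadsTo-sound _ ms t (proj₂ rest))
    where
    split = Equivalence.to (T-∧ {not ⌊ c i ≟ x ⌋}) ok
    rest = Equivalence.to (T-∧ {strong? (recolour c i x)}) (proj₂ split)

  -- Breadth-first search from t for a route to t from every reachable colouring; it needs no
  -- verification, since every route it proposes is re-checked by leadsTo.
  Table : Set
  Table = List (Colouring k 3 × List Move)

  explore : ℕ → Table → Table → Table
  explore zero _ seen = seen
  explore (suc fuel) frontier seen = uncurry (explore fuel) (foldl visit ([] , seen) frontier)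
    where
    visit : Table × Table → Colouring k 3 × List Move → Table × Table
    visit found (c , ms) = foldl try found (cartesianProduct (allFin k) (allFin 3))
      where
      try : Table × Table → Move → Table × Table
      try (new , seen′) (i , x) =
        if strong? c′ ∧ not (any (same? c′ ∘ proj₁) seen′)
        then (entry ∷ new , entry ∷ seen′)
        else (new , seen′)
        where
        c′ = recolour c i x
        entry = c′ , (i , c i) ∷ ms

  routes-to : Colouring k 3 → Table
  routes-to t = explore (3 ^ k) ((t , []) ∷ []) ((t , []) ∷ [])

  route : Table → Colouring k 3 → List Move
  route [] c = []
  route ((d , ms) ∷ table) c = if same? d c then ms else route table c

  routed : Colouring k 3 → Table → Colouring k 3 → Bool
  routed t table c = if strong? c then leadsTo c (route table c) t else true

  allVec : ∀ m → (Vec (Fin 3) m → Bool) → Bool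
  allVec zero p = p []
  allVec (suc m) p = allVec m (p ∘ (0F ∷_)) ∧ (allVec m (p ∘ (1F ∷_)) ∧ allVec m (p ∘ (2F ∷_)))

  Certified : Colouring k 3 → Table → Bool
  Certified t table = allVec k (routed t table ∘ Vec.lookup)

  private
    T-if : ∀ b {x} → T (if b then x else true) → T b → T x
    T-if true ok _ = ok

    allVec-sound : ∀ m p → T (allVec m p) → ∀ v → T (p v)
    allVec-sound zero p ok [] = ok
    allVec-sound (suc m) p ok (a ∷ v) with Equivalence.to (T-∧ {allVec m (p ∘ (0F ∷_))}) ok
    ... | ok₀ , rest with Equivalence.to (T-∧ {allVec m (p ∘ (1F ∷_))}) rest | a
    ...   | ok₁ , _ | 0F = allVec-sound m _ ok₀ v
    ...   | ok₁ , _ | 1F = allVec-sound m _ ok₁ v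
    ...   | _ , ok₂ | 2F = allVec-sound m _ ok₂ v

  certified-connected : ∀ t table → T (Certified t table) → SConnected 3 H
  certified-connected t table ok c d sc sd =
    SWalkOn⇒SWalk ∈-allFin (to-t c sc ▸ SWalkOn-reverse (Strong⇒StrongOn ∈-allFin sd) (to-t d sd))
    where
    to-t : ∀ c → Strong H c → SWalkOn (allFin k) c t
    to-t c sc = SWalkOn-from (λ i _ → lookup∘tabulate c i)
                  (leadsTo-sound c′ (route table c′) t
                    (T-if (strong? c′) (allVec-sound k _ ok v) (strong?-complete c′ sc′)))
      where
      v = Vec.tabulate c
      c′ = Vec.lookup v
      sc′ = strong-resp (λ i → ≡.sym (lookup∘tabulate c i)) sc

P5-edges : List (Fin 5 × Fin 5)
P5-edges = (0F , 1F) ∷ (1F , 2F) ∷ (2F , 3F) ∷ (3F , 4F) ∷ []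

P5-successor : ∀ {i j : Fin 5} → toℕ j ≡ suc (toℕ i) → (i , j) ∈ P5-edges
P5-successor {0F} {1F} refl = here refl
P5-successor {1F} {2F} refl = there (here refl)
P5-successor {2F} {3F} refl = there (there (here refl))
P5-successor {3F} {4F} refl = there (there (there (here refl)))

P5-listed : ∀ {i j} → P5Adj i j → (i , j) ∈ P5-edges ⊎ (j , i) ∈ P5-edges
P5-listed = Sum.map P5-successor P5-successor

P5-edge : ∀ {i j} → (i , j) ∈ P5-edges → P5Adj i j
P5-edge (here refl) = inj₁ refl
P5-edge (there (here refl)) = inj₁ refl
P5-edge (there (there (here refl))) = inj₁ refl
P5-edge (there (there (there (here refl)))) = inj₁ refl

module P5-certificate = Certificate P5 P5-edges P5-listed P5-edge
module I-certificate = Certificate I-graph I-edges (λ i∼j → i∼j) inj₁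

S₃-P5-connected : SConnected 3 P5
S₃-P5-connected = certified-connected t (routes-to t) _
  where
  open P5-certificate
  t = fromList (0F ∷ 1F ∷ 0F ∷ 1F ∷ 2F ∷ [])

S₃-I-connected : SConnected 3 I-graph
S₃-I-connected = certified-connected t (routes-to t) _
  where
  open I-certificate
  t = fromList (0F ∷ 1F ∷ 0F ∷ 2F ∷ 0F ∷ 2F ∷ [])

P5-connected : Connected P5
P5-connected = connected-via-root 1F λ
  { 0F → step (inj₁ refl) here
  ; 1F → here
  ; 2F → step (inj₂ refl) here
  ; 3F → step (inj₂ refl) (step (inj₂ refl) here)
  ; 4F → step (inj₂ refl) (step (inj₂ refl) (step (inj₂ refl) here)) }

I-connected : Connected I-graph
I-connected = connected-via-root 1F λ
  { 0F → step (inj₁ (here refl)) here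
  ; 1F → here
  ; 2F → step (inj₂ (there (here refl))) here
  ; 3F → step (inj₁ (there (there (here refl)))) 4→1
  ; 4F → 4→1
  ; 5F → step (inj₂ (there (there (there (here refl))))) 4→1 }
  where
  4→1 : Walk I-graph 4F 1F
  4→1 = step (inj₂ (there (there (there (there (here refl)))))) here

-- The two directions

module Sufficiency {n : ℕ} (T : Graph n) (tree : IsTree T) where
  open Colourings T
  open Growth T tree

  connected-from-subtree : ∀ {k} {H : Graph k} → Connected H → (x m y : Fin k) → Adj H x m → Adj H y m →
                           x ≢ y → SConnected 3 H → H ⊆G T → SConnected 3 T
  connected-from-subtree {H = H} connH x m y x∼m y∼m x≢y S₃H (f , f-inj , hom)
    with grow (λ S → Cherry S × SConnectedOn S) add-leaf rooted (cherry , connected-image S₃H)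
    where
    add-leaf : ∀ {S v} → Pendant S v → Cherry S × SConnectedOn S → Cherry (v ∷ S) × SConnectedOn (v ∷ S)
    add-leaf pendant (ch , conn) = cherry-∷ _ ch , LeafExtension.connected-∷ pendant ch conn
    open Embedding f f-inj
    open Image {G = T} hom (Forest.embedding-induced T (proj₂ tree) connH f f-inj hom)
    rooted : Rooted image (f m)
    rooted = ∈-image m , λ t t∈ → to-root (∈-image⁻ t∈)
      where
      to-root : ∀ {t} → ∃ (λ i → t ≡ f i) → WalkIn T (_∈ image) t (f m)
      to-root (i , refl) = walk-image (Walks.fromWalk H (connH i m))
    cherry : Cherry image
    cherry = record { x = f x ; m = f m ; y = f y ; x∈ = ∈-image x ; m∈ = ∈-image m ; y∈ = ∈-image y
                    ; x∼m = hom x m x∼m ; y∼m = hom y m y∼m ; x≢y = λ eq → x≢y (f-inj eq) }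
  ... | S , all∈ , _ , conn = covering-connected all∈ conn

module TreeShapes {n : ℕ} (T : Graph n) (tree : IsTree T) where
  open Walks T
  open Forest T (proj₂ tree)

  record TwoFar (x : Fin n) : Set where
    field
      w w′ : Fin n
      w≢x  : w ≢ x
      w′≢x : w′ ≢ x
      w≢w′ : w ≢ w′
      x≁w  : ¬ Adj T x w
      x≁w′ : ¬ Adj T x w′

  -- A walk x a b without backtracking, prolongable beyond b in case b is the avoided vertex e.
  record TwoStep (x e : Fin n) : Set where
    field
      a b    : Fin n
      x∼a    : Adj T x a
      a∼b    : Adj T a b
      x≢b    : x ≢ b
      beyond : b ≡ e → ∃ λ c → Adj T b c × a ≢ c

  two-step-towards : ∀ {x e w} → w ≢ x → ¬ Adj T x w → w ≢ e → TwoStep x e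
  two-step-towards {x} {e} {w} w≢x x≁w w≢e with shortcut (fromWalk (proj₁ tree x w))
  ... | [ _ ] , _ = ⊥-elim (w≢x refl)
  ... | _ ∷⟨ x∼a ⟩ [ _ ] , _ = ⊥-elim (x≁w x∼a)
  ... | _ ∷⟨ x∼a ⟩ (_ ∷⟨ a∼b ⟩ [ _ ]) , (_ ∷ x≢b ∷ _) ∷ _ =
        record { x∼a = x∼a ; a∼b = a∼b ; x≢b = x≢b ; beyond = ⊥-elim ∘ w≢e }
  ... | _ ∷⟨ x∼a ⟩ (_ ∷⟨ a∼b ⟩ (_ ∷⟨ b∼c ⟩ _)) , (_ ∷ x≢b ∷ _) ∷ (_ ∷ a≢c ∷ _) ∷ _ =
        record { x∼a = x∼a ; a∼b = a∼b ; x≢b = x≢b ; beyond = λ _ → _ , b∼c , a≢c }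

  two-step : ∀ {x} → TwoFar x → ∀ e → TwoStep x e
  two-step far e with TwoFar.w far ≟ e
  ... | yes refl = two-step-towards w′≢x x≁w′ (w≢w′ ∘ ≡.sym)
    where open TwoFar far
  ... | no w≢e = two-step-towards w≢x x≁w w≢e
    where open TwoFar far

  P5-from-walk : ∀ {v₀ v₁ v₂ v₃ v₄} → IsPath T (v₀ ∷ v₁ ∷ v₂ ∷ v₃ ∷ v₄ ∷ []) →
                 v₀ ≢ v₂ → v₁ ≢ v₃ → v₂ ≢ v₄ → P5 ⊆G T
  P5-from-walk {v₀} {v₁} {v₂} {v₃} {v₄} walk@(cons e₀₁ (cons e₁₂ (cons e₂₃ (cons e₃₄ _))))
               v₀≢v₂ v₁≢v₃ v₂≢v₄ =
    ⊆G-from-edges P5 T P5-edges P5-listed vertex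
      (lookup-injective (nonbacktracking-distinct walk (v₀≢v₂ , v₁≢v₃ , v₂≢v₄ , tt))) edge
    where
    vertex : Fin 5 → Fin n
    vertex = lookup (v₀ ∷ v₁ ∷ v₂ ∷ v₃ ∷ v₄ ∷ [])
    edge : ∀ {i j} → (i , j) ∈ P5-edges → Adj T (vertex i) (vertex j)
    edge (here refl) = e₀₁
    edge (there (here refl)) = e₁₂
    edge (there (there (here refl))) = e₂₃
    edge (there (there (there (here refl)))) = e₃₄

  -- The four non-backtracking walks through the centre edge p₁ p₂ certify all distinctness
  -- except between the two leaves at p₁ and between the two leaves at p₂.
  I-from-walks : ∀ {p₀ p₁ p₂ p₃ b b′} → Adj T p₀ p₁ → Adj T p₁ p₂ → Adj T p₂ p₃ → Adj T b′ p₁ → Adj T p₂ b →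
                 p₀ ≢ p₂ → p₁ ≢ p₃ → b′ ≢ p₂ → p₁ ≢ b → b′ ≢ p₀ → b ≢ p₃ → I-graph ⊆G T
  I-from-walks {p₀} {p₁} {p₂} {p₃} {b} {b′} e₀₁ e₁₂ e₂₃ e′₁ e₂b p₀≢p₂ p₁≢p₃ b′≢p₂ p₁≢b b′≢p₀ b≢p₃
    with nonbacktracking-distinct (cons e₀₁ (cons e₁₂ (cons e₂₃ (single _)))) (p₀≢p₂ , p₁≢p₃ , tt)
       | nonbacktracking-distinct (cons e′₁ (cons e₁₂ (cons e₂b (single _)))) (b′≢p₂ , p₁≢b , tt)
       | nonbacktracking-distinct (cons e₀₁ (cons e₁₂ (cons e₂b (single _)))) (p₀≢p₂ , p₁≢b , tt)
       | nonbacktracking-distinct (cons e′₁ (cons e₁₂ (cons e₂₃ (single _)))) (b′≢p₂ , p₁≢p₃ , tt)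
  ... | (p₀≢p₁ ∷ _ ∷ p₀≢p₃ ∷ []) ∷ (p₁≢p₂ ∷ _ ∷ []) ∷ (p₂≢p₃ ∷ []) ∷ _
      | (b′≢p₁ ∷ _ ∷ b′≢b ∷ []) ∷ _ ∷ (p₂≢b ∷ []) ∷ _
      | (_ ∷ _ ∷ p₀≢b ∷ []) ∷ _
      | (_ ∷ _ ∷ b′≢p₃ ∷ []) ∷ _ =
    ⊆G-from-edges I-graph T I-edges (λ i∼j → i∼j) vertex (lookup-injective distinct) edge
    where
    vertex : Fin 6 → Fin n
    vertex = lookup (p₀ ∷ p₁ ∷ b′ ∷ p₃ ∷ p₂ ∷ b ∷ [])
    distinct : AllPairs _≢_ (p₀ ∷ p₁ ∷ b′ ∷ p₃ ∷ p₂ ∷ b ∷ [])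
    distinct = (p₀≢p₁ ∷ (b′≢p₀ ∘ ≡.sym) ∷ p₀≢p₃ ∷ p₀≢p₂ ∷ p₀≢b ∷ []) ∷
               ((b′≢p₁ ∘ ≡.sym) ∷ p₁≢p₃ ∷ p₁≢p₂ ∷ p₁≢b ∷ []) ∷
               (b′≢p₃ ∷ b′≢p₂ ∷ b′≢b ∷ []) ∷
               ((p₂≢p₃ ∘ ≡.sym) ∷ (b≢p₃ ∘ ≡.sym) ∷ []) ∷
               (p₂≢b ∷ []) ∷ [] ∷ []
    edge : ∀ {i j} → (i , j) ∈ I-edges → Adj T (vertex i) (vertex j)
    edge (here refl) = e₀₁
    edge (there (here refl)) = sym T e′₁
    edge (there (there (here refl))) = sym T e₂₃
    edge (there (there (there (here refl)))) = e₂b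
    edge (there (there (there (there (here refl))))) = e₁₂

  record Path₄ : Set where
    field
      {p₀ p₁ p₂ p₃} : Fin n
      e₀₁   : Adj T p₀ p₁
      e₁₂   : Adj T p₁ p₂
      e₂₃   : Adj T p₂ p₃
      p₀≢p₂ : p₀ ≢ p₂
      p₁≢p₃ : p₁ ≢ p₃

  path₄ : (∀ x e → TwoStep x e) → Fin n → Path₄
  path₄ steps x₀ with steps x₀ x₀
  ... | record { a = a ; x∼a = x₀∼a ; a∼b = a∼b ; x≢b = x₀≢b } with steps a a
  ...   | record { a = a₁ ; x∼a = a∼a₁ ; a∼b = a₁∼b₁ ; x≢b = a≢b₁ } with a₁ ≟ x₀
  ...     | no a₁≢x₀ = record { e₀₁ = sym T a₁∼b₁ ; e₁₂ = sym T a∼a₁ ; e₂₃ = sym T x₀∼a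
                              ; p₀≢p₂ = a≢b₁ ∘ ≡.sym ; p₁≢p₃ = a₁≢x₀ }
  ...     | yes refl = record { e₀₁ = sym T a₁∼b₁ ; e₁₂ = x₀∼a ; e₂₃ = a∼b ; p₀≢p₂ = a≢b₁ ∘ ≡.sym ; p₁≢p₃ = x₀≢b }

  -- Look two steps from p₁ away from p₃ and from p₂ away from p₀: either a branch prolongs the
  -- path to a P₅, or p₁ and p₂ both carry an extra neighbour and the six vertices form an I.
  P5-or-I : (∀ x e → TwoStep x e) → Path₄ → P5 ⊆G T ⊎ I-graph ⊆G T
  P5-or-I steps record { p₀ = p₀ ; p₁ = p₁ ; p₂ = p₂ ; p₃ = p₃ ; e₀₁ = e₀₁ ; e₁₂ = e₁₂ ; e₂₃ = e₂₃
                       ; p₀≢p₂ = p₀≢p₂ ; p₁≢p₃ = p₁≢p₃ }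
    with steps p₁ p₃
  ... | record { a = a ; b = b ; x∼a = p₁∼a ; a∼b = a∼b ; x≢b = p₁≢b ; beyond = beyond } with a ≟ p₂
  ...   | no a≢p₂ = inj₁ (P5-from-walk (cons (sym T a∼b) (cons (sym T p₁∼a) (cons e₁₂ (cons e₂₃ (single _)))))
                                       (p₁≢b ∘ ≡.sym) a≢p₂ p₁≢p₃)
  ...   | yes refl with b ≟ p₃
  ...     | yes refl = let c , p₃∼c , p₂≢c = beyond refl in
                       inj₁ (P5-from-walk (cons e₀₁ (cons e₁₂ (cons e₂₃ (cons p₃∼c (single _))))) p₀≢p₂ p₁≢p₃ p₂≢c)
  ...     | no b≢p₃ with steps p₂ p₀
  ...       | record { a = a′ ; b = b′ ; x∼a = p₂∼a′ ; a∼b = a′∼b′ ; x≢b = p₂≢b′ ; beyond = beyond′ } with a′ ≟ p₁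
  ...         | no a′≢p₁ = inj₁ (P5-from-walk (cons e₀₁ (cons e₁₂ (cons p₂∼a′ (cons a′∼b′ (single _)))))
                                             p₀≢p₂ (a′≢p₁ ∘ ≡.sym) p₂≢b′)
  ...         | yes refl with b′ ≟ p₀
  ...           | yes refl = let c′ , p₀∼c′ , p₁≢c′ = beyond′ refl in
                             inj₁ (P5-from-walk (cons (sym T p₀∼c′) (cons e₀₁ (cons e₁₂ (cons e₂₃ (single _)))))
                                                (p₁≢c′ ∘ ≡.sym) p₀≢p₂ p₁≢p₃)
  ...           | no b′≢p₀ = inj₂ (I-from-walks e₀₁ e₁₂ e₂₃ (sym T a′∼b′) a∼b p₀≢p₂ p₁≢p₃ (p₂≢b′ ∘ ≡.sym)
                                                p₁≢b b′≢p₀ b≢p₃)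

  P5-or-I-of-two-far : (∀ x → TwoFar x) → Fin n → P5 ⊆G T ⊎ I-graph ⊆G T
  P5-or-I-of-two-far far x₀ = P5-or-I steps (path₄ steps x₀)
    where
    steps : ∀ x e → TwoStep x e
    steps x = two-step (far x)

  edge-or-two-steps : ∀ {u v} → u ≢ v → Adj T u v ⊎ ∃₂ λ x y → Adj T u x × Adj T x y × u ≢ y
  edge-or-two-steps {u} {v} u≢v with shortcut (fromWalk (proj₁ tree u v))
  ... | [ _ ] , _ = ⊥-elim (u≢v refl)
  ... | _ ∷⟨ u∼v ⟩ [ _ ] , _ = inj₁ u∼v
  ... | _ ∷⟨ u∼x ⟩ (_ ∷⟨ x∼y ⟩ _) , (_ ∷ u≢y ∷ _) ∷ _ = inj₂ (_ , _ , u∼x , x∼y , u≢y)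

  two-edge-path : ∀ {u v w} → u ≢ v → u ≢ w → v ≢ w → ∃₂ λ a x → ∃ λ y → Adj T a x × Adj T x y × a ≢ y
  two-edge-path {u} u≢v u≢w v≢w with edge-or-two-steps u≢v | edge-or-two-steps u≢w
  ... | inj₂ (x , y , path) | _ = u , x , y , path
  ... | inj₁ _ | inj₂ (x , y , path) = u , x , y , path
  ... | inj₁ u∼v | inj₁ u∼w = _ , u , _ , sym T u∼v , u∼w , v≢w

module Necessity {n : ℕ} (T : Graph n) (tree : IsTree T) where
  open Colourings T
  open Growth T tree
  open TreeShapes T tree

  strong-colouring : ∀ {a x y} → Adj T a x → Adj T x y → a ≢ y → ∃ (Strong T)
  strong-colouring {a} {x} {y} a∼x x∼y a≢y
    with grow (λ S → ∃ (StrongOn S)) add-leaf rooted (label , seed)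
    where
    a≢x : a ≢ x
    a≢x refl = irrefl T a∼x
    x≢y : x ≢ y
    x≢y refl = irrefl T x∼y
    vertex : Fin 3 → Fin n
    vertex = lookup (a ∷ x ∷ y ∷ [])
    open Embedding vertex (lookup-injective ((a≢x ∷ a≢y ∷ []) ∷ (x≢y ∷ []) ∷ [] ∷ []))
    label : Colouring n 3
    label = push (λ i → i)
    seed : StrongOn image label
    seed = proper , λ c → vertex c , ∈-image c , push-image (λ i → i) c
      where
      proper : ProperOn image label
      proper u v u∈ v∈ with ∈-image⁻ u∈ | ∈-image⁻ v∈
      ... | i , refl | j , refl = λ u∼v same-label → irrefl T (subst (Adj T (vertex i)) (cong vertex (≡.sym
              (trans (≡.sym (push-image (λ i → i) i)) (trans same-label (push-image (λ i → i) j))))) u∼v)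
    rooted : Rooted image x
    rooted = ∈-image 1F , λ t t∈ → to-x (∈-image⁻ t∈)
      where
      to-x : ∀ {t} → ∃ (λ i → t ≡ vertex i) → WalkIn T (_∈ image) t x
      to-x (0F , refl) = ∈-image 0F ∷⟨ a∼x ⟩ [ ∈-image 1F ]
      to-x (1F , refl) = [ ∈-image 1F ]
      to-x (2F , refl) = ∈-image 2F ∷⟨ sym T x∼y ⟩ [ ∈-image 1F ]
    add-leaf : ∀ {S v} → Pendant S v → ∃ (StrongOn S) → ∃ (StrongOn (v ∷ S))
    add-leaf {S} {v} pendant (c , sc) with fresh-colour (c anchor) (c anchor)
      where open Pendant pendant
    ... | colour , fresh , _ = recolour c v colour ,
          strong-leaf sc (recolour-≈ c colour) (λ eq → fresh (trans (≡.sym (recolour-same c v colour)) eq))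
      where open LeafExtension pendant
  ... | S , all∈ , c , sc = c , StrongOn⇒Strong all∈ sc

  rotate-strong : ∀ {c : Colouring n 3} → Strong T c → Strong T (rot ∘ c)
  rotate-strong {c} (pc , onto) = (λ u v e eq → pc u v e (rot-injective eq)) ,
    λ a → proj₁ (onto (rot (rot a))) , trans (cong rot (proj₂ (onto (rot (rot a))))) (rot³ a)

  recolouring-at : ∀ {c d : Colouring n 3} x → SWalk T c d → Strong T c → c x ≢ d x →
                   ∃₂ λ e₁ e₂ → Strong T e₁ × Strong T e₂ × DifferOnOne e₁ e₂ × e₁ x ≢ e₂ x
  recolouring-at x (done c≗d) _ ne = ⊥-elim (ne (c≗d x))
  recolouring-at {c} x (step {e = e} se diff w) sc ne with c x ≟ e x
  ... | yes eq = recolouring-at x w se (λ eq′ → ne (trans eq eq′))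
  ... | no ne′ = c , e , sc , se , diff , ne′

  -- The new colour of x already occurs in e₁ at some w, the old one still occurs in e₂ at some w′,
  -- and neither vertex can be adjacent to x.
  two-far-of-recolouring : ∀ {e₁ e₂ : Colouring n 3} x → Strong T e₁ → Strong T e₂ → DifferOnOne e₁ e₂ →
                           e₁ x ≢ e₂ x → TwoFar x
  two-far-of-recolouring {e₁} {e₂} x (pe₁ , onto₁) (pe₂ , onto₂) (u , _ , same) ne with x ≟ u
  ... | no x≢u = ⊥-elim (ne (same x x≢u))
  ... | yes refl = record { w = w ; w′ = w′ ; w≢x = w≢x ; w′≢x = w′≢x ; w≢w′ = w≢w′ ; x≁w = x≁w ; x≁w′ = x≁w′ }
    where
    w = proj₁ (onto₁ (e₂ x))
    w′ = proj₁ (onto₂ (e₁ x))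
    e₁w = proj₂ (onto₁ (e₂ x))
    e₂w′ = proj₂ (onto₂ (e₁ x))
    w≢x : w ≢ x
    w≢x w≡x = ne (trans (cong e₁ (≡.sym w≡x)) e₁w)
    w′≢x : w′ ≢ x
    w′≢x w′≡x = ne (≡.sym (trans (cong e₂ (≡.sym w′≡x)) e₂w′))
    x≁w : ¬ Adj T x w
    x≁w e = pe₂ x w e (≡.sym (trans (≡.sym (same w w≢x)) e₁w))
    x≁w′ : ¬ Adj T x w′
    x≁w′ e = pe₁ x w′ e (≡.sym (trans (same w′ w′≢x) e₂w′))
    w≢w′ : w ≢ w′
    w≢w′ w≡w′ = ne (≡.sym (trans (≡.sym e₁w) (trans (cong e₁ w≡w′) (trans (same w′ w′≢x) e₂w′))))

  two-far : SConnected 3 T → ∃ (Strong T) → ∀ x → TwoFar x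
  two-far S₃T (c , sc) x
    with recolouring-at x (S₃T c (rot ∘ c) sc (rotate-strong sc)) sc (rot-moves (c x) ∘ ≡.sym)
  ... | e₁ , e₂ , se₁ , se₂ , diff , ne = two-far-of-recolouring x se₁ se₂ diff ne

  necessary : ∀ {u v w} → u ≢ v → u ≢ w → v ≢ w → SConnected 3 T → P5 ⊆G T ⊎ I-graph ⊆G T
  necessary {u} u≢v u≢w v≢w S₃T with two-edge-path u≢v u≢w v≢w
  ... | _ , _ , _ , a∼x , x∼y , a≢y = P5-or-I-of-two-far (two-far S₃T (strong-colouring a∼x x∼y a≢y)) u

theorem5p2 : ∀ (n : ℕ) (T : Graph n) → IsTree T → 4 ≤ n →
    (SConnected 3 T → (P5 ⊆G T) ⊎ (I-graph ⊆G T)) ×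
    ((P5 ⊆G T) ⊎ (I-graph ⊆G T) → SConnected 3 T)
theorem5p2 _ T tree (s≤s (s≤s (s≤s (s≤s _)))) =
  necessary {0F} {1F} {2F} (λ ()) (λ ()) (λ ()) ,
  [ connected-from-subtree P5-connected 0F 1F 2F (inj₁ refl) (inj₂ refl) (λ ()) S₃-P5-connected
  , connected-from-subtree I-connected 0F 1F 2F (inj₁ (here refl)) (inj₂ (there (here refl))) (λ ())
                           S₃-I-connected ]′
  where
  open Necessity T tree
  open Sufficiency T tree
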